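{- Suppose $A[E]$ is surjectively relatively categorical. Let $\mathcal M$ be a model of $A^2[E]$ in which $\partial_1$ and $\partial_2$ are surjective, with induced structures $\mathcal M_1,\mathcal M_2$. Let $\overline H:\mathcal M_1\to\mathcal M_2$ be a map given on objects by $H$ and on relations by images under $H$, such that the restriction of $H$ to $\mathrm{rng}(\partial_1)$ is an element of $S_2[M]$. If $\overline H$ is an isomorphism of $L_0[\partial]$-structures, then $\overline H$ equals the natural bijection $\overline\Gamma:\mathcal M_1\to\mathcal M_2$.
   Context: Many-sorted second-order logic (objects; $n$-ary relations, unary ones called concepts) with Henkin semantics; $L_0$ has only predication relations. $E(X,Y)$ is an $L_0$-formula with two free concept variables, provably an equivalence relation. Theories include full comprehension for all formulas, the choice schema AC, and global choice GC (a linear order $<$ on objects in which every definable nonempty class has a least element). $A[E]$: $\forall X,Y(\partial(X)=\partial(Y)\leftrightarrow E(X,Y))$ plus these axioms; $A^2[E]$: the same axiom for two operators $\partial_1,\partial_2$ from concepts to objects, plus these axioms. Models of $A^2[E]$: $\mathcal M=(M,S_1[M],S_2[M],\dots,<,\partial_1,\partial_2)$. Induced $L_0[\partial]$-structures (without $<$): $\mathcal M_i=(\mathrm{rng}(\partial_i),S_1[M]\cap P(\mathrm{rng}(\partial_i)),S_2[M]\cap P(\mathrm{rng}(\partial_i)^2),\dots,\partial_i\restriction(S_1[M]\cap P(\mathrm{rng}(\partial_i))))$. Natural bijection $\overline\Gamma$: $\Gamma(\partial_1(X))=\partial_2(X)$ on objects, $\overline\Gamma(X)=\{\Gamma(x):x\in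 X\}$ on relations. $A[E]$ is surjectively relatively categorical if for all models of $A^2[E]$ in which $\partial_1,\partial_2$ are surjective onto $M$, $\overline\Gamma:\mathcal M_1\to\mathcal M_2$ is an isomorphism of $L_0[\partial]$-structures. -}

module Defs where

open import Data.Nat using (ℕ; zero; suc; _+_)
open import Data.Fin using (Fin) renaming (zero to fzero; suc to fsuc)
open import Data.Bool using (Bool; true; false; T)
open import Data.List using (List; []; _∷_; _++_; replicate)
open import Data.List.Membership.Propositional using (_∈_)
open import Data.List.Relation.Unary.All using (All; []; _∷_; lookup)
open import Data.Vec using (Vec; []; _∷_; map) renaming (_++_ to _++ᵛ_)
open import Data.Vec.Relation.Binary.Pointwise.Inductive using (Pointwise)
open import Data.Product using (Σ; ∃; _×_; _,_)
open import Data.Sum using (_⊎_)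
open import Data.Empty using (⊥)
open import Relation.Nullary using (¬_)
open import Relation.Binary.PropositionalEquality using (_≡_)
open import Function.Definitions using (Injective; StrictlySurjective)

_⇔_ : Set → Set → Set
A ⇔ B = (A → B) × (B → A)

Bij : {A B : Set} → (A → B) → Set
Bij f = Injective _≡_ _≡_ f × StrictlySurjective _≡_ f

Surj : {A B : Set} → (A → B) → Set
Surj f = StrictlySurjective _≡_ f

-- Sorts: objects, and relations.  `rel n` is the sort of relations of
-- arity (suc n) (so arities are 1,2,3,...; `rel 0` = concepts).

data Sort : Set where
  obj : Sort
  rel : ℕ → Sort

Ctx : Set
Ctx = List Sort

objs : ℕ → Ctx
objs n = replicate n obj

-- A signature: number of abstraction operators ∂ (from concepts to
-- objects) and whether the binary order symbol < is present.
record Sig : Set where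
  constructor sig
  field
    nd    : ℕ
    hasLt : Bool
open Sig public

σL0 : Sig
σL0 = sig 0 false

σL0< : Sig
σL0< = sig 0 true

σA2 : Sig
σA2 = sig 2 true

-- object terms (relation terms are just variables)
data Tm (σ : Sig) (Γ : Ctx) : Set where
  var : obj ∈ Γ → Tm σ Γ
  ∂̇   : Fin (nd σ) → rel 0 ∈ Γ → Tm σ Γ

data Fm (σ : Sig) (Γ : Ctx) : Set where
  app      : ∀ {n} → rel n ∈ Γ → Vec (Tm σ Γ) (suc n) → Fm σ Γ
  _≐_      : Tm σ Γ → Tm σ Γ → Fm σ Γ
  lt       : T (hasLt σ) → Tm σ Γ → Tm σ Γ → Fm σ Γ
  ⊥̇        : Fm σ Γ
  _⇒̇_ _∧̇_ _∨̇_ : Fm σ Γ → Fm σ Γ → Fm σ Γ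
  ∀̇ ∃̇      : (s : Sort) → Fm σ (s ∷ Γ) → Fm σ Γ

embT : ∀ {σ Γ} → Tm σL0 Γ → Tm σ Γ
embT (var x) = var x
embT (∂̇ () x)

embTs : ∀ {σ Γ n} → Vec (Tm σL0 Γ) n → Vec (Tm σ Γ) n
embTs [] = []
embTs (t ∷ ts) = embT t ∷ embTs ts

emb : ∀ {σ Γ} → Fm σL0 Γ → Fm σ Γ
emb (app x ts) = app x (embTs ts)
emb (s ≐ t) = embT s ≐ embT t
emb (lt () s t)
emb ⊥̇ = ⊥̇
emb (φ ⇒̇ ψ) = emb φ ⇒̇ emb ψ
emb (φ ∧̇ ψ) = emb φ ∧̇ emb ψ
emb (φ ∨̇ ψ) = emb φ ∨̇ emb ψ
emb (∀̇ s φ) = ∀̇ s (emb φ)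
emb (∃̇ s φ) = ∃̇ s (emb φ)

-- Henkin structures (general models).
-- Rel n is the set S_{n+1}[M] of relations of arity n+1 in the model;
-- relations are extensional subsets of M^(n+1).

record Str (σ : Sig) : Set₁ where
  field
    M    : Set
    Rel  : ℕ → Set
    _∈ʳ_ : ∀ {n} → Vec M (suc n) → Rel n → Set
    ext  : ∀ {n} (R R' : Rel n) → (∀ v → (v ∈ʳ R) ⇔ (v ∈ʳ R')) → R ≡ R'
    ∂    : Fin (nd σ) → Rel 0 → M
    _≺_  : M → M → Set          -- interpretation of < (unused if hasLt σ = false)

  ⟦_⟧ₛ : Sort → Set
  ⟦ obj ⟧ₛ   = M
  ⟦ rel n ⟧ₛ = Rel n

  Env : Ctx → Set
  Env Γ = All ⟦_⟧ₛ Γ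

  _++ₑ_ : ∀ {m Γ} → Vec M m → Env Γ → Env (objs m ++ Γ)
  [] ++ₑ ρ = ρ
  (a ∷ v) ++ₑ ρ = a ∷ (v ++ₑ ρ)

  evalT : ∀ {Γ} → Env Γ → Tm σ Γ → M
  evalT ρ (var x) = lookup ρ x
  evalT ρ (∂̇ i x) = ∂ i (lookup ρ x)

  evalTs : ∀ {Γ n} → Env Γ → Vec (Tm σ Γ) n → Vec M n
  evalTs ρ [] = []
  evalTs ρ (t ∷ ts) = evalT ρ t ∷ evalTs ρ ts

  Sat : ∀ {Γ} → Fm σ Γ → Env Γ → Set
  Sat (app x ts) ρ = evalTs ρ ts ∈ʳ lookup ρ x
  Sat (s ≐ t) ρ = evalT ρ s ≡ evalT ρ t
  Sat (lt _ s t) ρ = evalT ρ s ≺ evalT ρ t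
  Sat ⊥̇ ρ = ⊥
  Sat (φ ⇒̇ ψ) ρ = Sat φ ρ → Sat ψ ρ
  Sat (φ ∧̇ ψ) ρ = Sat φ ρ × Sat ψ ρ
  Sat (φ ∨̇ ψ) ρ = Sat φ ρ ⊎ Sat ψ ρ
  Sat (∀̇ s φ) ρ = (a : ⟦ s ⟧ₛ) → Sat φ (a ∷ ρ)
  Sat (∃̇ s φ) ρ = Σ ⟦ s ⟧ₛ λ a → Sat φ (a ∷ ρ)

  Comprehension : Set
  Comprehension = ∀ {Γ} n (φ : Fm σ (objs (suc n) ++ Γ)) (ρ : Env Γ) →
    Σ (Rel n) λ R → ∀ (v : Vec M (suc n)) → (v ∈ʳ R) ⇔ Sat φ (v ++ₑ ρ)

  Choice : Set
  Choice = ∀ {Γ} n m (φ : Fm σ (rel m ∷ objs (suc n) ++ Γ)) (ρ : Env Γ) →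
    (∀ (v : Vec M (suc n)) → Σ (Rel m) λ Y → Sat φ (Y ∷ (v ++ₑ ρ))) →
    Σ (Rel (n + suc m)) λ R → ∀ (v : Vec M (suc n)) →
      Σ (Rel m) λ Y → (∀ (w : Vec M (suc m)) → (w ∈ʳ Y) ⇔ ((v ++ᵛ w) ∈ʳ R))
                      × Sat φ (Y ∷ (v ++ₑ ρ))

  GlobalChoice : Set
  GlobalChoice =
    (∀ a → ¬ (a ≺ a)) ×
    (∀ a b c → a ≺ b → b ≺ c → a ≺ c) ×
    (∀ a b → (a ≺ b) ⊎ ((a ≡ b) ⊎ (b ≺ a))) ×
    (∀ {Γ} (φ : Fm σ (obj ∷ Γ)) (ρ : Env Γ) →
       (Σ M λ a → Sat φ (a ∷ ρ)) →
       Σ M λ a → Sat φ (a ∷ ρ) × (∀ b → Sat φ (b ∷ ρ) → ¬ (b ≺ a)))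

  BaseTheory : Set
  BaseTheory = Comprehension × Choice × GlobalChoice

  Abstraction : Fm σL0 (rel 0 ∷ rel 0 ∷ []) → Fin (nd σ) → Set
  Abstraction E i = ∀ (X Y : Rel 0) → (∂ i X ≡ ∂ i Y) ⇔ Sat (emb E) (X ∷ Y ∷ [])

open Str public

-- E(X,Y): formula with free concept variables X (index 0) and Y (index 1)
EFormula : Set
EFormula = Fm σL0 (rel 0 ∷ rel 0 ∷ [])

-- E is (provably) an equivalence relation: it defines an equivalence
-- relation on concepts in every model of the base theory (comprehension,
-- AC, GC) for L₀ ∪ {<}.
ProvablyEquivalence : EFormula → Set₁
ProvablyEquivalence E = ∀ (𝓝 : Str σL0<) → BaseTheory 𝓝 →
  let S = λ X Y → Sat 𝓝 (emb E) (X ∷ Y ∷ []) in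
  (∀ X → S X X) × (∀ X Y → S X Y → S Y X) × (∀ X Y Z → S X Y → S Y Z → S X Z)

-- Models of A²[E] (∂₁ is operator index 0, ∂₂ is operator index 1)
record ModelA2 (E : EFormula) : Set₁ where
  field
    str    : Str σA2
    base   : BaseTheory str
    abs₁   : Abstraction str E fzero
    abs₂   : Abstraction str E (fsuc fzero)

∂₁ ∂₂ : ∀ {E} (𝓜 : ModelA2 E) → Rel (ModelA2.str 𝓜) 0 → M (ModelA2.str 𝓜)
∂₁ 𝓜 = ∂ (ModelA2.str 𝓜) fzero
∂₂ 𝓜 = ∂ (ModelA2.str 𝓜) (fsuc fzero)

record L0∂Str : Set₁ where
  field
    Obj  : Set
    Rl   : ℕ → Set
    _∈ᵣ_ : ∀ {n} → Vec Obj (suc n) → Rl n → Set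
    ∂ᵣ   : Rl 0 → Obj
open L0∂Str public

-- Induced structure 𝓜ᵢ = (rng ∂ᵢ, S_n ∩ P(rng(∂ᵢ)^n), ∂ᵢ).  When ∂ᵢ is
-- surjective onto M, rng(∂ᵢ) = M and S_n ∩ P(M^n) = S_n, so the induced
-- structure is (M, S₁, S₂, …, ∂ᵢ).
inducedSurj : ∀ {E} (𝓜 : ModelA2 E) → (Rel (ModelA2.str 𝓜) 0 → M (ModelA2.str 𝓜)) → L0∂Str
inducedSurj 𝓜 d = record
  { Obj = M (ModelA2.str 𝓜) ; Rl = Rel (ModelA2.str 𝓜)
  ; _∈ᵣ_ = _∈ʳ_ (ModelA2.str 𝓜) ; ∂ᵣ = d }

𝓜₁ 𝓜₂ : ∀ {E} (𝓜 : ModelA2 E) → L0∂Str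
𝓜₁ 𝓜 = inducedSurj 𝓜 (∂₁ 𝓜)
𝓜₂ 𝓜 = inducedSurj 𝓜 (∂₂ 𝓜)

record IsIso (A B : L0∂Str) (f : Obj A → Obj B) (fᵣ : ∀ n → Rl A n → Rl B n) : Set where
  field
    bijObj : Bij f
    bijRel : ∀ n → Bij (fᵣ n)
    presPred : ∀ n (R : Rl A n) (v : Vec (Obj A) (suc n)) →
               _∈ᵣ_ A v R ⇔ _∈ᵣ_ B (map f v) (fᵣ n R)
    pres∂ : ∀ (X : Rl A 0) → f (∂ᵣ A X) ≡ ∂ᵣ B (fᵣ 0 X)

IsImageMap : (A : L0∂Str) (f : Obj A → Obj A) (fᵣ : ∀ n → Rl A n → Rl A n) → Set
IsImageMap A f fᵣ = ∀ n (R : Rl A n) (w : Vec (Obj A) (suc n)) →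
  _∈ᵣ_ A w (fᵣ n R) ⇔ (Σ (Vec (Obj A) (suc n)) λ v → _∈ᵣ_ A v R × map f v ≡ w)

NaturalBijectionIsIso : ∀ {E} (𝓜 : ModelA2 E) → Set
NaturalBijectionIsIso 𝓜 =
  Σ (M (ModelA2.str 𝓜) → M (ModelA2.str 𝓜)) λ G →
  Σ (∀ n → Rel (ModelA2.str 𝓜) n → Rel (ModelA2.str 𝓜) n) λ Gᵣ →
    (∀ X → G (∂₁ 𝓜 X) ≡ ∂₂ 𝓜 X) × IsImageMap (𝓜₁ 𝓜) G Gᵣ × IsIso (𝓜₁ 𝓜) (𝓜₂ 𝓜) G Gᵣ

SurjRelCategorical : EFormula → Set₁
SurjRelCategorical E = ∀ (𝓜 : ModelA2 E) → Surj (∂₁ 𝓜) → Surj (∂₂ 𝓜) →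
  NaturalBijectionIsIso 𝓜

ΓGraph : ∀ {E} (𝓜 : ModelA2 E) → M (ModelA2.str 𝓜) → M (ModelA2.str 𝓜) → Set
ΓGraph 𝓜 a b = Σ (Rel (ModelA2.str 𝓜) 0) λ X → (∂₁ 𝓜 X ≡ a) × (∂₂ 𝓜 X ≡ b)

EqualsNaturalBijection : ∀ {E} (𝓜 : ModelA2 E) (H : M (ModelA2.str 𝓜) → M (ModelA2.str 𝓜))
  (Hᵣ : ∀ n → Rel (ModelA2.str 𝓜) n → Rel (ModelA2.str 𝓜) n) → Set
EqualsNaturalBijection 𝓜 H Hᵣ =
  (∀ X → H (∂₁ 𝓜 X) ≡ ∂₂ 𝓜 X) ×
  (∀ n R (w : Vec (M (ModelA2.str 𝓜)) (suc n)) →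
     _∈ʳ_ (ModelA2.str 𝓜) w (Hᵣ n R) ⇔
     (Σ (Vec (M (ModelA2.str 𝓜)) (suc n)) λ v →
        _∈ʳ_ (ModelA2.str 𝓜) v R × Pointwise (ΓGraph 𝓜) v w))

RestrictionInS2 : ∀ {E} (𝓜 : ModelA2 E) (H : M (ModelA2.str 𝓜) → M (ModelA2.str 𝓜)) → Set
RestrictionInS2 𝓜 H = Σ (Rel (ModelA2.str 𝓜) 1) λ R →
  ∀ a b → _∈ʳ_ (ModelA2.str 𝓜) (a ∷ b ∷ []) R ⇔ ((Σ (Rel (ModelA2.str 𝓜) 0) λ X → ∂₁ 𝓜 X ≡ a) × H a ≡ b)

-- Replace ∂₂ in 𝓜 by the operator X ↦ H(∂₁ X).  Because the graph
-- of H is a binary relation RH of the model, the new operator is definable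
-- from ∂₁ and the parameter RH, so every formula about the new structure
-- translates into an equivalent formula about the old one.  Hence the new
-- structure 𝓜' is again a model of A²[E] (comprehension, choice and global
-- choice transfer through the translation; the abstraction axioms transfer
-- because H is injective and E mentions no ∂).  In 𝓜' the natural
-- bijection is H itself, so categoricity says that H̄ is an isomorphism
-- 𝓜'₁ → 𝓜'₂, i.e. H(∂₁ X) = H(∂₁ (H̄ X)); thus H̄ preserves ∂₁.  As
-- ∂₁ and ∂₂ have the same kernel E, H̄ also preserves ∂₂, and since H̄ is
-- an isomorphism 𝓜₁ → 𝓜₂ we get H(∂₁ X) = ∂₂(H̄ X) = ∂₂ X, i.e. H = Γ.

module Submission where

open import Defs
open import Data.Nat using (zero; suc)
open import Data.Fin using (Fin) renaming (zero to fzero; suc to fsuc)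
open import Data.List using ([]; _∷_; _++_)
open import Data.List.Membership.Propositional using (_∈_)
open import Data.List.Relation.Unary.Any using (here; there)
open import Data.List.Relation.Unary.All using ([]; _∷_; lookup)
import Data.List.Relation.Unary.All as All
open import Data.List.Relation.Unary.All.Properties using (lookup-map)
open import Data.Vec using (Vec; []; _∷_; map)
open import Data.Vec.Properties using (map-cong; ∷-injective)
open import Data.Vec.Relation.Binary.Pointwise.Inductive using (Pointwise; []; _∷_)
open import Data.Product using (Σ; _×_; _,_; proj₁; proj₂)
import Data.Product as Product
import Data.Sum as Sum
open import Function using (_∘_; id)
open import Function.Definitions using (Injective)
open import Relation.Binary.PropositionalEquality
  using (_≡_; refl; sym; trans; cong; cong₂; subst; module ≡-Reasoning)

⇔-refl : {A : Set} → A ⇔ A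
⇔-refl = id , id

⇔-sym : {A B : Set} → A ⇔ B → B ⇔ A
⇔-sym (f , g) = g , f

⇔-trans : {A B C : Set} → A ⇔ B → B ⇔ C → A ⇔ C
⇔-trans (f , g) (f' , g') = f' ∘ f , g ∘ g'

≡⇒⇔ : {A B : Set} → A ≡ B → A ⇔ B
≡⇒⇔ refl = ⇔-refl

⇔-→ : {A A' B B' : Set} → A ⇔ A' → B ⇔ B' → (A → B) ⇔ (A' → B')
⇔-→ (f , g) (f' , g') = (λ h → f' ∘ h ∘ g) , (λ h → g' ∘ h ∘ f)

⇔-× : {A A' B B' : Set} → A ⇔ A' → B ⇔ B' → (A × B) ⇔ (A' × B')
⇔-× (f , g) (f' , g') = Product.map f f' , Product.map g g'

⇔-⊎ : {A A' B B' : Set} → A ⇔ A' → B ⇔ B' → (A Sum.⊎ B) ⇔ (A' Sum.⊎ B')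
⇔-⊎ (f , g) (f' , g') = Sum.map f f' , Sum.map g g'

⇔-Π : {A : Set} {P Q : A → Set} → (∀ a → P a ⇔ Q a) → ((a : A) → P a) ⇔ ((a : A) → Q a)
⇔-Π e = (λ h a → proj₁ (e a) (h a)) , (λ h a → proj₂ (e a) (h a))

⇔-Σ : {A : Set} {P Q : A → Set} → (∀ a → P a ⇔ Q a) → Σ A P ⇔ Σ A Q
⇔-Σ e = Product.map₂ (λ {a} → proj₁ (e a)) , Product.map₂ (λ {a} → proj₂ (e a))

injective-⇔ : {A B : Set} {f : A → B} → Injective _≡_ _≡_ f → ∀ {a b} → (f a ≡ f b) ⇔ (a ≡ b)
injective-⇔ inj = inj , cong _

agree-on-range : {A B C : Set} {d : A → B} → Surj d → {f g : B → C} →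
                 (∀ a → f (d a) ≡ g (d a)) → ∀ b → f b ≡ g b
agree-on-range surj agree b with surj b
... | a , refl = agree a

∘-surj : {A B C : Set} {f : A → B} {g : B → C} → Surj f → Surj g → Surj (g ∘ f)
∘-surj {g = g} surjF surjG c with surjG c
... | b , refl = let (a , e) = surjF b in a , cong g e

Ren : Ctx → Ctx → Set
Ren Γ Δ = ∀ {s} → s ∈ Γ → s ∈ Δ

liftR : ∀ {Γ Δ s} → Ren Γ Δ → Ren (s ∷ Γ) (s ∷ Δ)
liftR r (here p) = here p
liftR r (there x) = there (r x)

shiftK : ∀ {Δ} k → Ren Δ (objs k ++ Δ)
shiftK zero x = x
shiftK (suc k) x = there (shiftK k x)

insertAt : ∀ {Γ s} k → Ren (objs k ++ Γ) (objs k ++ s ∷ Γ)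
insertAt zero = there
insertAt (suc k) = liftR (insertAt k)

insertedVar : ∀ {Γ s} k → s ∈ (objs k ++ s ∷ Γ)
insertedVar zero = here refl
insertedVar (suc k) = there (insertedVar k)

leadingVars : ∀ {σ Δ Δ'} k → Ren (objs k ++ Δ) Δ' → Vec (Tm σ Δ') k
leadingVars zero r = []
leadingVars (suc k) r = var (r (here refl)) ∷ leadingVars k (r ∘ there)

exK : ∀ {σ Δ} k → Fm σ (objs k ++ Δ) → Fm σ Δ
exK zero φ = φ
exK (suc k) φ = exK k (∃̇ obj φ)

module Prenex {σ : Sig} (S : Str σ) where

  lookup-shift : ∀ {Δ} k (v : Vec (M S) k) (τ : Env S Δ) {s} (x : s ∈ Δ) →
                 lookup (_++ₑ_ S v τ) (shiftK k x) ≡ lookup τ x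
  lookup-shift zero [] τ x = refl
  lookup-shift (suc k) (a ∷ v) τ x = lookup-shift k v τ x

  eval-leadingVars : ∀ {Δ Δ'} k (r : Ren (objs k ++ Δ) Δ') (σ' : Env S Δ')
                     (v : Vec (M S) k) (τ : Env S Δ) →
                     (∀ (x : obj ∈ objs k ++ Δ) → lookup σ' (r x) ≡ lookup (_++ₑ_ S v τ) x) →
                     evalTs S σ' (leadingVars k r) ≡ v
  eval-leadingVars zero r σ' [] τ agree = refl
  eval-leadingVars (suc k) r σ' (a ∷ v) τ agree =
    cong₂ _∷_ (agree (here refl)) (eval-leadingVars k (r ∘ there) σ' v τ (agree ∘ there))

  sat-exK : ∀ {Δ} k (φ : Fm σ (objs k ++ Δ)) (τ : Env S Δ) →
            Sat S (exK k φ) τ ⇔ Σ (Vec (M S) k) λ v → Sat S φ (_++ₑ_ S v τ)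
  sat-exK zero φ τ = (λ p → [] , p) , λ { ([] , p) → p }
  sat-exK (suc k) φ τ =
    ⇔-trans (sat-exK k (∃̇ obj φ) τ)
      ((λ { (v , a , p) → a ∷ v , p }) , λ { (a ∷ v , p) → v , a , p })

-- A formula over a
-- context Γ is sent to a formula over Δ, where r : Ren Γ Δ relocates the
-- variables and h points at a binary relation variable standing for the
-- graph of H; the term ∂₂ X is read as "the y with h(∂₁ X, y)".

defines : ∀ {Γ Δ} → Ren Γ Δ → rel 1 ∈ Δ → Tm σA2 Γ → Tm σA2 Δ → Fm σA2 Δ
defines r h (var x) u = u ≐ var (r x)
defines r h (∂̇ fzero x) u = u ≐ ∂̇ fzero (r x)
defines r h (∂̇ (fsuc fzero) x) u = app h (∂̇ fzero (r x) ∷ u ∷ [])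

definesAll : ∀ {Γ Δ k} → Ren Γ Δ → rel 1 ∈ Δ → Vec (Tm σA2 Γ) k → Vec (Tm σA2 Δ) k → Fm σA2 Δ
definesAll r h [] [] = ⊥̇ ⇒̇ ⊥̇
definesAll r h (t ∷ ts) (u ∷ us) = defines r h t u ∧̇ definesAll r h ts us

atom : ∀ {Γ Δ} k → Ren Γ Δ → rel 1 ∈ Δ → Vec (Tm σA2 Γ) k → Fm σA2 (objs k ++ Δ) → Fm σA2 Δ
atom k r h ts core = exK k (definesAll (shiftK k ∘ r) (shiftK k h) ts (leadingVars k id) ∧̇ core)

tr : ∀ {Γ Δ} → Ren Γ Δ → rel 1 ∈ Δ → Fm σA2 Γ → Fm σA2 Δ
tr r h (app {n} x ts) = atom (suc n) r h ts (app (shiftK (suc n) (r x)) (leadingVars (suc n) id))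
tr r h (s ≐ t) = atom 2 r h (s ∷ t ∷ []) (var (here refl) ≐ var (there (here refl)))
tr r h (lt p s t) = atom 2 r h (s ∷ t ∷ []) (lt p (var (here refl)) (var (there (here refl))))
tr r h ⊥̇ = ⊥̇
tr r h (φ ⇒̇ ψ) = tr r h φ ⇒̇ tr r h ψ
tr r h (φ ∧̇ ψ) = tr r h φ ∧̇ tr r h ψ
tr r h (φ ∨̇ ψ) = tr r h φ ∨̇ tr r h ψ
tr r h (∀̇ s φ) = ∀̇ s (tr (liftR r) (there h) φ)
tr r h (∃̇ s φ) = ∃̇ s (tr (liftR r) (there h) φ)

translate : ∀ {Γ} k → Fm σA2 (objs k ++ Γ) → Fm σA2 (objs k ++ rel 1 ∷ Γ)
translate k = tr (insertAt k) (insertedVar k)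

module Twist (S : Str σA2) (H : M S → M S) (RH : Rel S 1)
             (graphH : ∀ a b → _∈ʳ_ S (a ∷ b ∷ []) RH ⇔ (H a ≡ b)) where

  open Prenex S

  twisted∂ : Fin 2 → Rel S 0 → M S
  twisted∂ fzero = ∂ S fzero
  twisted∂ (fsuc fzero) X = H (∂ S fzero X)

  S' : Str σA2
  S' = record S { ∂ = twisted∂ }

  cast : ∀ s → ⟦_⟧ₛ S' s → ⟦_⟧ₛ S s
  cast obj a = a
  cast (rel n) X = X

  conv : ∀ {Γ} → Env S' Γ → Env S Γ
  conv = All.map λ {s} → cast s

  Agree : ∀ {Γ Δ} → Ren Γ Δ → Env S' Γ → Env S Δ → Set
  Agree {Γ} r ρ σ = ∀ {s} (x : s ∈ Γ) → lookup σ (r x) ≡ cast s (lookup ρ x)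

  Tracks : ∀ {Γ Δ} → Ren Γ Δ → rel 1 ∈ Δ → Env S' Γ → Env S Δ → Set
  Tracks r h ρ σ = Agree r ρ σ × lookup σ h ≡ RH

  lift : ∀ {Γ Δ} {r : Ren Γ Δ} {h ρ σ} s (a : ⟦_⟧ₛ S' s) →
         Tracks r h ρ σ → Tracks (liftR {s = s} r) (there h) (a ∷ ρ) (cast s a ∷ σ)
  lift s a (agree , atH) = (λ { (here refl) → refl ; (there x) → agree x }) , atH

  shifted : ∀ {Γ Δ} {r : Ren Γ Δ} {h σ} k (v : Vec (M S) k) {ρ} → Tracks r h ρ σ →
            Tracks (shiftK k ∘ r) (shiftK k h) ρ (_++ₑ_ S v σ)
  shifted k v (agree , atH) =
    (λ x → trans (lookup-shift k v _ _) (agree x)) , trans (lookup-shift k v _ _) atH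

  sat-defines : ∀ {Γ Δ} {r : Ren Γ Δ} {h ρ σ} → Tracks r h ρ σ → (t : Tm σA2 Γ) (u : Tm σA2 Δ) →
                Sat S (defines r h t u) σ ⇔ (evalT S σ u ≡ evalT S' ρ t)
  sat-defines (agree , atH) (var x) u rewrite agree x = ⇔-refl
  sat-defines (agree , atH) (∂̇ fzero x) u rewrite agree x = ⇔-refl
  sat-defines (agree , atH) (∂̇ (fsuc fzero) x) u rewrite agree x | atH =
    ⇔-trans (graphH _ _) (sym , sym)

  sat-definesAll : ∀ {Γ Δ k} {r : Ren Γ Δ} {h ρ σ} → Tracks r h ρ σ →
                   (ts : Vec (Tm σA2 Γ) k) (us : Vec (Tm σA2 Δ) k) →
                   Sat S (definesAll r h ts us) σ ⇔ (evalTs S σ us ≡ evalTs S' ρ ts)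
  sat-definesAll tracks [] [] = (λ _ → refl) , (λ _ → id)
  sat-definesAll tracks (t ∷ ts) (u ∷ us) =
    ⇔-trans (⇔-× (sat-defines tracks t u) (sat-definesAll tracks ts us))
      ((λ { (e , es) → cong₂ _∷_ e es }) , ∷-injective)

  sat-atom : ∀ {Γ Δ} k {r : Ren Γ Δ} {h ρ σ} → Tracks r h ρ σ →
             (ts : Vec (Tm σA2 Γ) k) (core : Fm σA2 (objs k ++ Δ)) →
             Sat S (atom k r h ts core) σ ⇔ Sat S core (_++ₑ_ S (evalTs S' ρ ts) σ)
  sat-atom k {r} {h} {ρ} {σ} tracks ts core =
    ⇔-trans (sat-exK k _ σ)
      ((λ { (v , d , c) → subst (λ w → Sat S core (_++ₑ_ S w σ)) (proj₁ (denote v) d) c }) ,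
       (λ c → evalTs S' ρ ts , proj₂ (denote _) refl , c))
    where
    denote : ∀ v → Sat S (definesAll (shiftK k ∘ r) (shiftK k h) ts (leadingVars k id)) (_++ₑ_ S v σ)
                   ⇔ (v ≡ evalTs S' ρ ts)
    denote v = ⇔-trans (sat-definesAll (shifted k v {ρ = ρ} tracks) ts (leadingVars k id))
      (≡⇒⇔ (cong (_≡ evalTs S' ρ ts) (eval-leadingVars k id (_++ₑ_ S v σ) v σ λ _ → refl)))

  sat-tr : ∀ {Γ Δ} (r : Ren Γ Δ) (h : rel 1 ∈ Δ) (φ : Fm σA2 Γ) (ρ : Env S' Γ) (σ : Env S Δ) →
           Tracks r h ρ σ → Sat S' φ ρ ⇔ Sat S (tr r h φ) σ
  sat-tr r h (app {n} x ts) ρ σ tracks =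
    ⇔-trans (≡⇒⇔ (cong₂ (_∈ʳ_ S) (sym (eval-leadingVars (suc n) id _ w σ λ _ → refl))
                                  (sym (proj₁ (shifted (suc n) w {ρ = ρ} tracks) x))))
            (⇔-sym (sat-atom (suc n) {ρ = ρ} tracks ts _))
    where w = evalTs S' ρ ts
  sat-tr r h (s ≐ t) ρ σ tracks =
    ⇔-sym (sat-atom 2 {ρ = ρ} tracks (s ∷ t ∷ []) (var (here refl) ≐ var (there (here refl))))
  sat-tr r h (lt p s t) ρ σ tracks =
    ⇔-sym (sat-atom 2 {ρ = ρ} tracks (s ∷ t ∷ []) (lt p (var (here refl)) (var (there (here refl)))))
  sat-tr r h ⊥̇ ρ σ tracks = ⇔-refl
  sat-tr r h (φ ⇒̇ ψ) ρ σ tracks = ⇔-→ (sat-tr r h φ ρ σ tracks) (sat-tr r h ψ ρ σ tracks)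
  sat-tr r h (φ ∧̇ ψ) ρ σ tracks = ⇔-× (sat-tr r h φ ρ σ tracks) (sat-tr r h ψ ρ σ tracks)
  sat-tr r h (φ ∨̇ ψ) ρ σ tracks = ⇔-⊎ (sat-tr r h φ ρ σ tracks) (sat-tr r h ψ ρ σ tracks)
  sat-tr r h (∀̇ obj φ) ρ σ tracks =
    ⇔-Π λ a → sat-tr (liftR r) (there h) φ (a ∷ ρ) (a ∷ σ) (lift obj a tracks)
  sat-tr r h (∀̇ (rel m) φ) ρ σ tracks =
    ⇔-Π λ X → sat-tr (liftR r) (there h) φ (X ∷ ρ) (X ∷ σ) (lift (rel m) X tracks)
  sat-tr r h (∃̇ obj φ) ρ σ tracks =
    ⇔-Σ λ a → sat-tr (liftR r) (there h) φ (a ∷ ρ) (a ∷ σ) (lift obj a tracks)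
  sat-tr r h (∃̇ (rel m) φ) ρ σ tracks =
    ⇔-Σ λ X → sat-tr (liftR r) (there h) φ (X ∷ ρ) (X ∷ σ) (lift (rel m) X tracks)

  tracks-insert : ∀ {Γ} k (v : Vec (M S) k) (ρ : Env S' Γ) →
                  Tracks (insertAt k) (insertedVar k) (_++ₑ_ S' v ρ) (_++ₑ_ S v (RH ∷ conv ρ))
  tracks-insert zero [] ρ = lookup-map ρ , refl
  tracks-insert (suc k) (a ∷ v) ρ = lift obj a (tracks-insert k v ρ)

  sat-translate : ∀ {Γ} k (v : Vec (M S) k) (ρ : Env S' Γ) (φ : Fm σA2 (objs k ++ Γ)) →
                  Sat S' φ (_++ₑ_ S' v ρ) ⇔ Sat S (translate k φ) (_++ₑ_ S v (RH ∷ conv ρ))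
  sat-translate k v ρ φ = sat-tr (insertAt k) (insertedVar k) φ _ _ (tracks-insert k v ρ)

  -- Formulas of L₀ do not mention ∂, so S and S' agree on them.
  eval-emb : ∀ {Γ n} (ρ : Env S' Γ) (ts : Vec (Tm σL0 Γ) n) →
             evalTs S (conv ρ) (embTs ts) ≡ evalTs S' ρ (embTs ts)
  eval-emb ρ [] = refl
  eval-emb ρ (var x ∷ ts) = cong₂ _∷_ (lookup-map ρ x) (eval-emb ρ ts)

  sat-emb : ∀ {Γ} (φ : Fm σL0 Γ) (ρ : Env S' Γ) → Sat S' (emb φ) ρ ⇔ Sat S (emb φ) (conv ρ)
  sat-emb (app x ts) ρ = ≡⇒⇔ (sym (cong₂ (_∈ʳ_ S) (eval-emb ρ ts) (lookup-map ρ x)))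
  sat-emb (var x ≐ var y) ρ = ≡⇒⇔ (sym (cong₂ _≡_ (lookup-map ρ x) (lookup-map ρ y)))
  sat-emb ⊥̇ ρ = ⇔-refl
  sat-emb (φ ⇒̇ ψ) ρ = ⇔-→ (sat-emb φ ρ) (sat-emb ψ ρ)
  sat-emb (φ ∧̇ ψ) ρ = ⇔-× (sat-emb φ ρ) (sat-emb ψ ρ)
  sat-emb (φ ∨̇ ψ) ρ = ⇔-⊎ (sat-emb φ ρ) (sat-emb ψ ρ)
  sat-emb (∀̇ obj φ) ρ = ⇔-Π λ a → sat-emb φ (a ∷ ρ)
  sat-emb (∀̇ (rel m) φ) ρ = ⇔-Π λ X → sat-emb φ (X ∷ ρ)
  sat-emb (∃̇ obj φ) ρ = ⇔-Σ λ a → sat-emb φ (a ∷ ρ)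
  sat-emb (∃̇ (rel m) φ) ρ = ⇔-Σ λ X → sat-emb φ (X ∷ ρ)

  comprehension : Comprehension S → Comprehension S'
  comprehension comp n φ ρ =
    let (R , spec) = comp n (translate (suc n) φ) (RH ∷ conv ρ) in
    R , λ v → ⇔-trans (spec v) (⇔-sym (sat-translate (suc n) v ρ φ))

  choice : Choice S → Choice S'
  choice ch {Γ} n m φ ρ total =
    let (R , spec) = ch n m φ* (RH ∷ conv ρ) (λ v → Product.map₂ (proj₁ (sat* v _)) (total v)) in
    R , λ v → Product.map₂ (Product.map₂ (proj₂ (sat* v _))) (spec v)
    where
    φ* : Fm σA2 (rel m ∷ objs (suc n) ++ rel 1 ∷ Γ)
    φ* = tr (liftR (insertAt (suc n))) (there (insertedVar (suc n))) φ
    sat* : ∀ v Y → Sat S' φ (Y ∷ _++ₑ_ S' v ρ) ⇔ Sat S φ* (Y ∷ _++ₑ_ S v (RH ∷ conv ρ))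
    sat* v Y = sat-tr _ _ φ _ _ (lift (rel m) Y (tracks-insert (suc n) v ρ))

  globalChoice : GlobalChoice S → GlobalChoice S'
  globalChoice (irrefl , transitive , total , least) =
    irrefl , transitive , total , λ φ ρ (a , p) →
      let (b , q , minimal) = least (translate 1 φ) (RH ∷ conv ρ) (a , proj₁ (sat a φ ρ) p) in
      b , proj₂ (sat b φ ρ) q , λ c r → minimal c (proj₁ (sat c φ ρ) r)
    where
    sat : ∀ {Γ} a (φ : Fm σA2 (obj ∷ Γ)) (ρ : Env S' Γ) →
          Sat S' φ (a ∷ ρ) ⇔ Sat S (translate 1 φ) (a ∷ RH ∷ conv ρ)
    sat a φ ρ = sat-translate 1 (a ∷ []) ρ φ

  baseTheory : BaseTheory S → BaseTheory S'
  baseTheory (comp , ch , gc) = comprehension comp , choice ch , globalChoice gc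

  -- Both operators of S' satisfy the abstraction axiom of ∂₁ in S.
  abstraction₁ : ∀ E → Abstraction S E fzero → Abstraction S' E fzero
  abstraction₁ E abs X Y = ⇔-trans (abs X Y) (⇔-sym (sat-emb E (X ∷ Y ∷ [])))

  abstraction₂ : ∀ E → Injective _≡_ _≡_ H → Abstraction S E fzero → Abstraction S' E (fsuc fzero)
  abstraction₂ E inj abs X Y = ⇔-trans (injective-⇔ inj) (abstraction₁ E abs X Y)

twistedModel : ∀ {E} (𝓜 : ModelA2 E) (H : M (ModelA2.str 𝓜) → M (ModelA2.str 𝓜)) →
               Injective _≡_ _≡_ H → (RH : Rel (ModelA2.str 𝓜) 1) →
               (∀ a b → _∈ʳ_ (ModelA2.str 𝓜) (a ∷ b ∷ []) RH ⇔ (H a ≡ b)) → ModelA2 E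
twistedModel {E} 𝓜 H inj RH graphH = record
  { str = S'
  ; base = baseTheory (ModelA2.base 𝓜)
  ; abs₁ = abstraction₁ E (ModelA2.abs₁ 𝓜)
  ; abs₂ = abstraction₂ E inj (ModelA2.abs₁ 𝓜)
  }
  where open Twist (ModelA2.str 𝓜) H RH graphH

-- In a model of A²[E] both operators have kernel E, so they identify
-- the same concepts.
same-kernel : ∀ {E} (𝓜 : ModelA2 E) {X Y} → ∂₁ 𝓜 X ≡ ∂₁ 𝓜 Y → ∂₂ 𝓜 X ≡ ∂₂ 𝓜 Y
same-kernel 𝓜 {X} {Y} e = proj₂ (ModelA2.abs₂ 𝓜 X Y) (proj₁ (ModelA2.abs₁ 𝓜 X Y) e)

-- By extensionality, the image map along a function is unique.
imageMap-unique : ∀ {E} (𝓜 : ModelA2 E) {f g fᵣ gᵣ} →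
                  IsImageMap (𝓜₁ 𝓜) f fᵣ → IsImageMap (𝓜₁ 𝓜) g gᵣ →
                  (∀ a → f a ≡ g a) → ∀ n R → fᵣ n R ≡ gᵣ n R
imageMap-unique 𝓜 imgF imgG f≗g n R = ext (ModelA2.str 𝓜) _ _ λ w →
  ⇔-trans (imgF n R w)
    (⇔-trans (⇔-Σ λ v → ⇔-× ⇔-refl (≡⇒⇔ (cong (_≡ w) (map-cong f≗g v))))
             (⇔-sym (imgG n R w)))

-- With ∂₁ surjective, the hypothesis that H restricted to rng ∂₁ lies in
-- S₂ says that the graph of H is a binary relation of the model.
restriction-graph : ∀ {E} (𝓜 : ModelA2 E) → Surj (∂₁ 𝓜) → ∀ {H} → RestrictionInS2 𝓜 H →
                    Σ (Rel (ModelA2.str 𝓜) 1) λ RH →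
                      ∀ a b → _∈ʳ_ (ModelA2.str 𝓜) (a ∷ b ∷ []) RH ⇔ (H a ≡ b)
restriction-graph 𝓜 surj₁ (RH , spec) =
  RH , λ a b → ⇔-trans (spec a b) (proj₂ , λ e → surj₁ a , e)

-- In the twisted model 𝓜' the natural bijection must be H itself, and
-- H̄ is the image map along H; so if Γ̄ of 𝓜' is an isomorphism 𝓜'₁ → 𝓜'₂,
-- then H(∂₁ X) = ∂₂'(H̄ X) = H(∂₁ (H̄ X)), whence H̄ preserves ∂₁.
twisted-naturality : ∀ {E} (𝓜 : ModelA2 E) → Surj (∂₁ 𝓜) →
  (H : M (ModelA2.str 𝓜) → M (ModelA2.str 𝓜)) (injH : Injective _≡_ _≡_ H) →
  (Hᵣ : ∀ n → Rel (ModelA2.str 𝓜) n → Rel (ModelA2.str 𝓜) n) →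
  IsImageMap (𝓜₁ 𝓜) H Hᵣ → (RH : Rel (ModelA2.str 𝓜) 1) →
  (graphH : ∀ a b → _∈ʳ_ (ModelA2.str 𝓜) (a ∷ b ∷ []) RH ⇔ (H a ≡ b)) →
  NaturalBijectionIsIso (twistedModel 𝓜 H injH RH graphH) → ∀ X → ∂₁ 𝓜 (Hᵣ 0 X) ≡ ∂₁ 𝓜 X
twisted-naturality 𝓜 surj₁ H injH Hᵣ imgH RH graphH (G , Gᵣ , G-natural , imgG , isoG) X =
  injH (begin
    H (∂₁ 𝓜 (Hᵣ 0 X))  ≡⟨ cong (λ Y → H (∂₁ 𝓜 Y)) (imageMap-unique 𝓜 imgH imgG H≗G 0 X) ⟩
    H (∂₁ 𝓜 (Gᵣ 0 X))  ≡⟨ sym (IsIso.pres∂ isoG X) ⟩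
    G (∂₁ 𝓜 X)         ≡⟨ G-natural X ⟩
    H (∂₁ 𝓜 X)         ∎)
  where
  open ≡-Reasoning
  H≗G : ∀ a → H a ≡ G a
  H≗G = agree-on-range surj₁ (λ Y → sym (G-natural Y))

-- Key step: categoricity, applied to the twisted model, shows that an
-- isomorphism H̄ : 𝓜₁ → 𝓜₂ whose graph is in the model preserves ∂₁.
iso-preserves-∂₁ : ∀ {E} → SurjRelCategorical E → (𝓜 : ModelA2 E) → Surj (∂₁ 𝓜) →
  (H : M (ModelA2.str 𝓜) → M (ModelA2.str 𝓜)) →
  (Hᵣ : ∀ n → Rel (ModelA2.str 𝓜) n → Rel (ModelA2.str 𝓜) n) →
  IsImageMap (𝓜₁ 𝓜) H Hᵣ → (RH : Rel (ModelA2.str 𝓜) 1) →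
  (∀ a b → _∈ʳ_ (ModelA2.str 𝓜) (a ∷ b ∷ []) RH ⇔ (H a ≡ b)) →
  IsIso (𝓜₁ 𝓜) (𝓜₂ 𝓜) H Hᵣ → ∀ X → ∂₁ 𝓜 (Hᵣ 0 X) ≡ ∂₁ 𝓜 X
iso-preserves-∂₁ cat 𝓜 surj₁ H Hᵣ imgH RH graphH iso =
  twisted-naturality 𝓜 surj₁ H injH Hᵣ imgH RH graphH
    (cat (twistedModel 𝓜 H injH RH graphH) surj₁ (∘-surj surj₁ surjH))
  where
  injH : Injective _≡_ _≡_ H
  injH = proj₁ (IsIso.bijObj iso)
  surjH : Surj H
  surjH = proj₂ (IsIso.bijObj iso)

-- Consequently H agrees with Γ: H(∂₁ X) = ∂₂(H̄ X) = ∂₂ X.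
H-natural : ∀ {E} → SurjRelCategorical E → (𝓜 : ModelA2 E) → Surj (∂₁ 𝓜) →
  (H : M (ModelA2.str 𝓜) → M (ModelA2.str 𝓜)) →
  (Hᵣ : ∀ n → Rel (ModelA2.str 𝓜) n → Rel (ModelA2.str 𝓜) n) →
  IsImageMap (𝓜₁ 𝓜) H Hᵣ → RestrictionInS2 𝓜 H →
  IsIso (𝓜₁ 𝓜) (𝓜₂ 𝓜) H Hᵣ → ∀ X → H (∂₁ 𝓜 X) ≡ ∂₂ 𝓜 X
H-natural cat 𝓜 surj₁ H Hᵣ imgH restr iso X =
  let (RH , graphH) = restriction-graph 𝓜 surj₁ restr in
  trans (IsIso.pres∂ iso X)
        (same-kernel 𝓜 (iso-preserves-∂₁ cat 𝓜 surj₁ H Hᵣ imgH RH graphH iso X))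

graphΓ : ∀ {E} (𝓜 : ModelA2 E) → Surj (∂₁ 𝓜) → (H : M (ModelA2.str 𝓜) → M (ModelA2.str 𝓜)) →
         (∀ X → H (∂₁ 𝓜 X) ≡ ∂₂ 𝓜 X) → ∀ a b → ΓGraph 𝓜 a b ⇔ (H a ≡ b)
graphΓ 𝓜 surj₁ H natural a b =
  (λ { (X , refl , refl) → natural X }) ,
  (λ { refl → let (X , e) = surj₁ a in X , e , trans (sym (natural X)) (cong H e) })

pointwise-graph : ∀ {A : Set} {P : A → A → Set} (f : A → A) → (∀ a b → P a b ⇔ (f a ≡ b)) →
                  ∀ {k} (v w : Vec A k) → Pointwise P v w ⇔ (map f v ≡ w)
pointwise-graph f graph [] [] = (λ _ → refl) , (λ _ → [])
pointwise-graph f graph (a ∷ v) (b ∷ w) =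
  (λ { (p ∷ ps) → cong₂ _∷_ (proj₁ (graph a b) p) (proj₁ (pointwise-graph f graph v w) ps) }) ,
  (λ { refl → proj₂ (graph a b) refl ∷ proj₂ (pointwise-graph f graph v w) refl })

corollary12 : (E : EFormula) → ProvablyEquivalence E → SurjRelCategorical E →
    (𝓜 : ModelA2 E) → Surj (∂₁ 𝓜) → Surj (∂₂ 𝓜) →
    (H : M (ModelA2.str 𝓜) → M (ModelA2.str 𝓜)) →
    (Hᵣ : ∀ n → Rel (ModelA2.str 𝓜) n → Rel (ModelA2.str 𝓜) n) →
    IsImageMap (𝓜₁ 𝓜) H Hᵣ → RestrictionInS2 𝓜 H →
    IsIso (𝓜₁ 𝓜) (𝓜₂ 𝓜) H Hᵣ →
    EqualsNaturalBijection 𝓜 H Hᵣ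
corollary12 E _ cat 𝓜 surj₁ _ H Hᵣ imgH restr iso =
  natural ,
  -- H̄ R is the H-image of R, and the graph of H is the graph of Γ.
  λ n R w → ⇔-trans (imgH n R w)
    (⇔-Σ λ v → ⇔-× ⇔-refl (⇔-sym (pointwise-graph H (graphΓ 𝓜 surj₁ H natural) v w)))
  where
  natural : ∀ X → H (∂₁ 𝓜 X) ≡ ∂₂ 𝓜 X
  natural = H-natural cat 𝓜 surj₁ H Hᵣ imgH restr iso
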